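{- Let $G$ be a finite simple graph, with $(H,H')$, $M$, $M_A$, $H_A$ as in the standing setting below. Then $M\cap H = M\setminus M_A = H\setminus H_A$.
   Context: $\nu(G)$ is the maximum matching size. $B_2(G)$ is the set of pairs $(H,H')$ of edge-disjoint matchings; $\lambda_2(G)=\max\{|H|+|H'|:(H,H')\in B_2(G)\}$; $\alpha_2(G)=\max\{|H|,|H'|:(H,H')\in B_2(G),\ |H|+|H'|=\lambda_2(G)\}$; $M_2(G)=\{(H,H')\in B_2(G): |H|+|H'|=\lambda_2(G),\ |H|=\alpha_2(G)\}$. For matchings $A,B$: a path or even cycle $e_1,\dots,e_l$ ($l\ge1$) is $A$-$B$ alternating if the edges with odd indices lie in $A\setminus B$ and the others in $B\setminus A$, or vice versa; an alternating path is maximal if it is not a proper subpath of another $A$-$B$ alternating path. $P(A,B)$ is the set of maximal $A$-$B$ alternating paths, $P_o(A,B)$ those of odd length, and $P_o^A(A,B)$ those in $P_o(A,B)$ whose first edge is in $A$. Standing setting: over all $(H,H')\in M_2(G)$ and all maximum matchings $M$ of $G$, consider the triples maximizing $|M\cap H|$; among these, $((H,H'),M)$ is chosen to maximize $|M\cap H'|$. $M_A$ (resp. $H_A$) is the set of edges lying on paths of $P_o^M(M,H)$ that belong to $M$ (resp. $H$). -}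

module Defs where

open import Data.Nat using (ℕ; zero; suc; _+_; _≤_; _<_; _%_)
open import Data.Bool using (Bool; true; false; if_then_else_)
open import Data.Fin using (Fin; toℕ; inject₁)
open import Data.Fin.Subset using (Subset; _∈_; _∉_; _∩_; ∣_∣)
open import Data.Product using (Σ; _×_; _,_)
open import Data.Sum using (_⊎_)
open import Data.Empty using (⊥)
open import Relation.Nullary using (¬_)
open import Relation.Binary.PropositionalEquality using (_≡_; _≢_)

record Graph : Set where
  field
    n m     : ℕ
    src tgt : Fin m → Fin n
    loopless : ∀ e → src e ≢ tgt e
    noMulti  : ∀ e f →
      ((src e ≡ src f × tgt e ≡ tgt f) ⊎ (src e ≡ tgt f × tgt e ≡ src f)) → e ≡ f

module _ (G : Graph) where
  open Graph G

  Inc : Fin m → Fin n → Set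
  Inc e v = src e ≡ v ⊎ tgt e ≡ v

  Joins : Fin m → Fin n → Fin n → Set
  Joins e u v = (src e ≡ u × tgt e ≡ v) ⊎ (src e ≡ v × tgt e ≡ u)

  IsMatching : Subset m → Set
  IsMatching A = ∀ e f → e ∈ A → f ∈ A → e ≢ f → ∀ v → Inc e v → Inc f v → ⊥

  IsMaximumMatching : Subset m → Set
  IsMaximumMatching M = IsMatching M × (∀ N → IsMatching N → ∣ N ∣ ≤ ∣ M ∣)

  InB2 : Subset m → Subset m → Set
  InB2 H H' = IsMatching H × IsMatching H' × (∀ e → e ∈ H → e ∈ H' → ⊥)

  IsLambda2Pair : Subset m → Subset m → Set
  IsLambda2Pair H H' = InB2 H H' × (∀ K K' → InB2 K K' → ∣ K ∣ + ∣ K' ∣ ≤ ∣ H ∣ + ∣ H' ∣)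

  -- (H , H') ∈ M₂(G): additionally |H| = α₂(G), i.e. |H| is at least
  -- max(|K|,|K'|) for every pair (K , K') attaining λ₂(G)
  InM2 : Subset m → Subset m → Set
  InM2 H H' = IsLambda2Pair H H' ×
    (∀ K K' → IsLambda2Pair K K' → (∣ K ∣ ≤ ∣ H ∣) × (∣ K' ∣ ≤ ∣ H ∣))

  StandingChoice : Subset m → Subset m → Subset m → Set
  StandingChoice H H' M =
    InM2 H H' × IsMaximumMatching M ×
    (∀ K K' N → InM2 K K' → IsMaximumMatching N → ∣ N ∩ K ∣ ≤ ∣ M ∩ H ∣) ×
    (∀ K K' N → InM2 K K' → IsMaximumMatching N →
       ∣ N ∩ K ∣ ≡ ∣ M ∩ H ∣ → ∣ N ∩ K' ∣ ≤ ∣ M ∩ H' ∣)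

  -- a path e₁,…,e_len (len ≥ 1 is imposed in IsAltPath) with distinct
  -- vertices vert 0,…,vert len; edge i joins vert i and vert (i+1)
  record Path : Set where
    field
      len  : ℕ
      vert : Fin (suc len) → Fin n
      vinj : ∀ i j → vert i ≡ vert j → i ≡ j
      edge : Fin len → Fin m
      joins : ∀ i → Joins (edge i) (vert (inject₁ i)) (vert (Data.Fin.suc i))
  open Path public

  isEven : ℕ → Bool
  isEven k = if (k % 2 Data.Nat.≡ᵇ 0) then true else false

  InDiff : Subset m → Subset m → Fin m → Set
  InDiff A B e = e ∈ A × e ∉ B

  -- A-B alternating path (0-based index i corresponds to e_{i+1})
  IsAltPath : Subset m → Subset m → Path → Set
  IsAltPath A B p = (1 ≤ len p) ×
    ((∀ i → (if isEven (toℕ i) then InDiff A B (edge p i) else InDiff B A (edge p i)))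
     ⊎ (∀ i → (if isEven (toℕ i) then InDiff B A (edge p i) else InDiff A B (edge p i))))

  ProperSubpath : Path → Path → Set
  ProperSubpath p q = (len p < len q) × Σ ℕ (λ k → (k + len p ≤ len q) ×
    (∀ (i : Fin (len p)) (j : Fin (len q)) → toℕ j ≡ k + toℕ i → edge p i ≡ edge q j))

  IsMaximalAltPath : Subset m → Subset m → Path → Set
  IsMaximalAltPath A B p = IsAltPath A B p ×
    (∀ q → IsAltPath A B q → ProperSubpath p q → ⊥)

  InPoA : Subset m → Subset m → Path → Set
  InPoA A B p = IsMaximalAltPath A B p × (isEven (len p) ≡ false) ×
    (∀ i → toℕ i ≡ 0 → edge p i ∈ A)

  OnPoM : Subset m → Subset m → Subset m → Fin m → Set
  OnPoM M H X e = e ∈ X × Σ Path (λ p → InPoA M H p × Σ (Fin (len p)) (λ i → edge p i ≡ e))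

  InMA : Subset m → Subset m → Fin m → Set
  InMA M H = OnPoM M H M

  InHA : Subset m → Subset m → Fin m → Set
  InHA M H = OnPoM M H H

module Submission where

-- In the standing setting M is a maximum matching and (H , H′) ∈ M₂(G), chosen so that |M ∩ H| is
-- as large as possible.  Every maximal M-H alternating path then starts and ends with an edge of M:
-- otherwise exchanging M and H along the path (together with the edge of M ∖ H that may join its two
-- ends into an even alternating cycle) yields a matching N with |N| ≥ |M|, hence maximum, and
-- |N ∩ H| > |M ∩ H|.  So P_o^M(M,H) consists of all maximal alternating paths.  An edge of M ∩ H lies
-- on no alternating path, while an edge of M ∖ H (or H ∖ M) is a one-edge alternating path and
-- therefore lies on a maximal one, i.e. in M_A (or H_A).

open import Defs
import Data.Nat.Properties as ℕ
open import Algebra.Properties.CommutativeMonoid.Sum ℕ.+-0-commutativeMonoid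
  using (sum; sum-cong-≗; ∑-distrib-+; sum-replicate-zero)
open import Data.Bool using (Bool; true; false; not; _∧_; _∨_; if_then_else_)
open import Data.Bool.Properties using (not-involutive; ∨-zeroʳ; ¬-not; not-¬) renaming (_≟_ to _≟ᵇ_)
open import Data.Empty using (⊥; ⊥-elim)
open import Data.Fin using (Fin; toℕ; inject₁; fromℕ; fromℕ<; _≟_) renaming (zero to fzero; suc to fsuc)
open import Data.Fin.Properties
  using ( suc-injective; any?; toℕ-injective; toℕ-inject₁; toℕ-fromℕ; toℕ-fromℕ<; toℕ<n
        ; inject₁-injective; injective⇒≤)
open import Data.Fin.Subset using (Subset; _∈_; _∉_; _∩_; ∣_∣)
open import Data.Fin.Subset.Properties using (_∈?_)
open import Data.Nat using (ℕ; zero; suc; _+_; _≤_; _<_; z≤n; s≤s)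
open import Data.Nat.Properties
  using ( +-comm; +-assoc; +-identityʳ; m≤n+m; ≤-refl; ≤-reflexive; ≤-trans; +-cancelʳ-≤; +-monoʳ-≤
        ; module ≤-Reasoning)
open import Data.Product using (Σ; _×_; _,_; proj₁; proj₂)
open import Data.Sum using (_⊎_; inj₁; inj₂)
open import Data.Vec using ([]; _∷_; lookup; tabulate)
open import Data.Vec.Functional using (Vector; insertAt)
open import Data.Vec.Functional.Properties using (insertAt-lookup)
open import Data.Vec.Properties using (lookup∘tabulate; lookup-zipWith; []=⇒lookup; lookup⇒[]=)
open import Function using (_∘_; id)
open import Function.Bundles using (_⇔_; mk⇔)
open import Relation.Binary.PropositionalEquality
open import Relation.Nullary using (¬_; Dec; yes; no; does; _⊎-dec_; _×-dec_)
open import Relation.Nullary.Decidable using (dec-true; dec-false)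

does-true : ∀ {p} {P : Set p} (P? : Dec P) → does P? ≡ true → P
does-true (yes p) _ = p

lookup-∉ : ∀ {m} (A : Subset m) {e} → e ∉ A → lookup A e ≡ false
lookup-∉ A {e} e∉A with lookup A e in Ae
... | true  = ⊥-elim (e∉A (lookup⇒[]= e A Ae))
... | false = refl

∉-lookup : ∀ {m} (A : Subset m) {e} → lookup A e ≡ false → e ∉ A
∉-lookup A Ae e∈A with () ← trans (sym ([]=⇒lookup e∈A)) Ae

inject₁-or-last : ∀ {k} (i : Fin (suc k)) → (Σ (Fin k) λ j → i ≡ inject₁ j) ⊎ i ≡ fromℕ k
inject₁-or-last {zero}  fzero    = inj₂ refl
inject₁-or-last {suc k} fzero    = inj₁ (fzero , refl)
inject₁-or-last {suc k} (fsuc i) with inject₁-or-last i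
... | inj₁ (j , refl) = inj₁ (fsuc j , refl)
... | inj₂ refl       = inj₂ refl

insertAt-last-inject₁ : ∀ {a} {A : Set a} {k} (xs : Vector A k) (v : A) (j : Fin k) →
  insertAt xs (fromℕ k) v (inject₁ j) ≡ xs j
insertAt-last-inject₁ {k = suc k} xs v fzero    = refl
insertAt-last-inject₁ {k = suc k} xs v (fsuc j) = insertAt-last-inject₁ (xs ∘ fsuc) v j

𝟙 : Bool → ℕ
𝟙 true  = 1
𝟙 false = 0

𝟙-not : ∀ b → 𝟙 b + 𝟙 (not b) ≡ 1
𝟙-not true  = refl
𝟙-not false = refl

𝟙-∨-disjoint : ∀ o c a → (c ≡ true → o ≡ false) → (c ≡ true → a ≡ true) →
  𝟙 ((o ∨ c) ∧ a) ≡ 𝟙 (o ∧ a) + 𝟙 c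
𝟙-∨-disjoint true  false _ _  _  = sym (+-identityʳ _)
𝟙-∨-disjoint false false _ _  _  = refl
𝟙-∨-disjoint false true  a _  a≡ rewrite a≡ refl = refl
𝟙-∨-disjoint true  true  _ o≡ _  with () ← o≡ refl

𝟙-∨-absent : ∀ o c a → (c ≡ true → a ≡ false) → 𝟙 ((o ∨ c) ∧ a) ≡ 𝟙 (o ∧ a)
𝟙-∨-absent true  _     _ _  = refl
𝟙-∨-absent false false _ _  = refl
𝟙-∨-absent false true  a a≡ rewrite a≡ refl = refl

count : ∀ {k} → (Fin k → Bool) → ℕ
count f = sum (𝟙 ∘ f)

count-cong : ∀ {k} {f g : Fin k → Bool} → (∀ i → f i ≡ g i) → count f ≡ count g
count-cong f≗g = sum-cong-≗ (cong 𝟙 ∘ f≗g)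

count-split : ∀ {k} (f g h : Fin k → Bool) → (∀ i → 𝟙 (f i) ≡ 𝟙 (g i) + 𝟙 (h i)) →
  count f ≡ count g + count h
count-split f g h split = trans (sum-cong-≗ split) (∑-distrib-+ (𝟙 ∘ g) (𝟙 ∘ h))

count-exchange : ∀ {k} (f g h j : Fin k → Bool) →
  (∀ i → 𝟙 (f i) + 𝟙 (g i) ≡ 𝟙 (h i) + 𝟙 (j i)) → count f + count g ≡ count h + count j
count-exchange f g h j exchange = begin
  count f + count g              ≡⟨ ∑-distrib-+ (𝟙 ∘ f) (𝟙 ∘ g) ⟨
  sum (λ i → 𝟙 (f i) + 𝟙 (g i))  ≡⟨ sum-cong-≗ exchange ⟩
  sum (λ i → 𝟙 (h i) + 𝟙 (j i))  ≡⟨ ∑-distrib-+ (𝟙 ∘ h) (𝟙 ∘ j) ⟩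
  count h + count j              ∎
  where open ≡-Reasoning

count-false : ∀ {k} (f : Fin k → Bool) → (∀ i → f i ≡ false) → count f ≡ 0
count-false {k} f none = trans (count-cong none) (sum-replicate-zero k)

count-true : ∀ {k} (f : Fin k → Bool) (i : Fin k) → f i ≡ true → 1 ≤ count f
count-true f fzero    fi rewrite fi = s≤s z≤n
count-true f (fsuc i) fi = ≤-trans (count-true (f ∘ fsuc) i fi) (m≤n+m _ (𝟙 (f fzero)))

count-unique : ∀ {k} (f : Fin k → Bool) → (∀ i j → f i ≡ true → f j ≡ true → i ≡ j) → count f ≤ 1
count-unique {zero}  f unique = z≤n
count-unique {suc k} f unique with f fzero in f0
... | true  = ≤-reflexive (cong suc (count-false (f ∘ fsuc) rest-false))
  where
  rest-false : ∀ i → f (fsuc i) ≡ false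
  rest-false i with f (fsuc i) in fi
  ... | true  with () ← unique fzero (fsuc i) f0 fi
  ... | false = refl
... | false = count-unique (f ∘ fsuc) (λ i j fi fj → suc-injective (unique (fsuc i) (fsuc j) fi fj))

count-point : ∀ {k} (x : Fin k) (a : Fin k → Bool) → count (λ e → does (x ≟ e) ∧ a e) ≡ 𝟙 (a x)
count-point {suc k} fzero    a = trans (cong (𝟙 (a fzero) +_) (count-false {k} _ (λ _ → refl))) (+-identityʳ _)
count-point {suc k} (fsuc x) a = count-point x (a ∘ fsuc)

inImage : ∀ {k m} → (Fin k → Fin m) → Fin m → Bool
inImage g e = does (any? (λ i → g i ≟ e))

count-image : ∀ {k m} (g : Fin k → Fin m) → (∀ i j → g i ≡ g j → i ≡ j) → (a : Fin m → Bool) →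
  count (λ e → inImage g e ∧ a e) ≡ count (a ∘ g)
count-image {zero}  {m} g inj a = count-false {m} _ (λ _ → refl)
count-image {suc k}     g inj a = begin
  count (λ e → inImage g e ∧ a e)
    ≡⟨ count-split _ _ _ head-or-tail ⟩
  count (λ e → does (g fzero ≟ e) ∧ a e) + count (λ e → inImage (g ∘ fsuc) e ∧ a e)
    ≡⟨ cong₂ _+_ (count-point (g fzero) a) (count-image (g ∘ fsuc) inj-tail a) ⟩
  count (a ∘ g) ∎
  where
  open ≡-Reasoning
  inj-tail : ∀ i j → g (fsuc i) ≡ g (fsuc j) → i ≡ j
  inj-tail i j eq = suc-injective (inj (fsuc i) (fsuc j) eq)
  head-or-tail : ∀ e →
    𝟙 (inImage g e ∧ a e) ≡ 𝟙 (does (g fzero ≟ e) ∧ a e) + 𝟙 (inImage (g ∘ fsuc) e ∧ a e)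
  head-or-tail e with g fzero ≟ e | any? (λ i → g (fsuc i) ≟ e)
  ... | no _     | _              = refl
  ... | yes _    | no _           = sym (+-identityʳ _)
  ... | yes g0≡e | yes (i , gi≡e) with () ← inj fzero (fsuc i) (trans g0≡e (sym gi≡e))

∣∣≡count : ∀ {m} (A : Subset m) → ∣ A ∣ ≡ count (lookup A)
∣∣≡count []          = refl
∣∣≡count (true ∷ A)  = cong suc (∣∣≡count A)
∣∣≡count (false ∷ A) = ∣∣≡count A

∣∩∣≡count : ∀ {m} (A B : Subset m) → ∣ A ∩ B ∣ ≡ count (λ e → lookup A e ∧ lookup B e)
∣∩∣≡count A B = trans (∣∣≡count (A ∩ B)) (count-cong (λ e → lookup-zipWith _∧_ e A B))

-- Alternating colours

alternate : Bool → ℕ → Bool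
alternate s zero    = s
alternate s (suc k) = not (alternate s k)

alternate-not : ∀ s k → alternate (not s) k ≡ not (alternate s k)
alternate-not s zero    = refl
alternate-not s (suc k) = cong not (alternate-not s k)

count-alternate : ∀ L →
  count {L} (alternate true ∘ toℕ) ≡ count {L} (alternate false ∘ toℕ) + 𝟙 (alternate false L)
count-alternate zero    = refl
count-alternate (suc L) = begin
  1 + count {L} (not ∘ alternate true ∘ toℕ)   ≡⟨ cong suc (count-cong {L} (sym ∘ alternate-not true ∘ toℕ)) ⟩
  1 + A false                                 ≡⟨ +-comm 1 (A false) ⟩
  A false + 1                                 ≡⟨ cong (A false +_) (𝟙-not a) ⟨
  A false + (𝟙 a + 𝟙 (not a))                 ≡⟨ +-assoc (A false) _ _ ⟨
  A false + 𝟙 a + 𝟙 (not a)                   ≡⟨ cong (_+ 𝟙 (not a)) (count-alternate L) ⟨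
  A true + 𝟙 (not a)                          ≡⟨ cong (_+ 𝟙 (not a)) (count-cong {L} (alternate-not false ∘ toℕ)) ⟩
  count {L} (not ∘ alternate false ∘ toℕ) + 𝟙 (not a) ∎
  where
  open ≡-Reasoning
  A : Bool → ℕ
  A s = count {L} (alternate s ∘ toℕ)
  a : Bool
  a = alternate false L

isEven-suc : ∀ G k → isEven G (suc k) ≡ not (isEven G k)
isEven-suc G zero          = refl
isEven-suc G (suc zero)    = refl
isEven-suc G (suc (suc k)) = isEven-suc G k

alternate-isEven : ∀ G s k → alternate s k ≡ (if isEven G k then s else not s)
alternate-isEven G s zero    = refl
alternate-isEven G s (suc k) rewrite alternate-isEven G s k | isEven-suc G k with isEven G k
... | true  = refl
... | false = not-involutive s

isEven≡alternate-true : ∀ G k → isEven G k ≡ alternate true k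
isEven≡alternate-true G k rewrite alternate-isEven G true k with isEven G k
... | true  = refl
... | false = refl

-- Exchanging matchings on a set of edges

swapIn : ∀ {m} → (Fin m → Bool) → Subset m → Subset m → Subset m
swapIn c M H = tabulate (λ e → if c e then lookup H e else lookup M e)

lookup-swapIn : ∀ {m} (c : Fin m → Bool) (M H : Subset m) e →
  lookup (swapIn c M H) e ≡ (if c e then lookup H e else lookup M e)
lookup-swapIn c M H = lookup∘tabulate _

∈-swapIn : ∀ {m} (c : Fin m → Bool) (M H : Subset m) {e} → e ∈ swapIn c M H →
  (c e ≡ true × e ∈ H) ⊎ (c e ≡ false × e ∈ M)
∈-swapIn c M H {e} e∈ with c e in ce | trans (sym (lookup-swapIn c M H e)) ([]=⇒lookup e∈)
... | true  | He = inj₁ (refl , lookup⇒[]= e H He)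
... | false | Me = inj₂ (refl , lookup⇒[]= e M Me)

countIn : ∀ {m} → (Fin m → Bool) → Subset m → ℕ
countIn c A = count (λ e → c e ∧ lookup A e)

module _ {m} (c : Fin m → Bool) (M H : Subset m) where

  ∣swapIn∣+countIn≡ : ∣ swapIn c M H ∣ + countIn c M ≡ ∣ M ∣ + countIn c H
  ∣swapIn∣+countIn≡ = begin
    ∣ swapIn c M H ∣ + countIn c M                 ≡⟨ cong (_+ countIn c M) (∣∣≡count (swapIn c M H)) ⟩
    count (lookup (swapIn c M H)) + countIn c M    ≡⟨ cong (_+ countIn c M) (count-cong (lookup-swapIn c M H)) ⟩
    count swapped + countIn c M                    ≡⟨ count-exchange _ _ _ _ exchange ⟩
    count (lookup M) + countIn c H                 ≡⟨ cong (_+ countIn c H) (∣∣≡count M) ⟨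
    ∣ M ∣ + countIn c H                            ∎
    where
    open ≡-Reasoning
    swapped : Fin m → Bool
    swapped e = if c e then lookup H e else lookup M e
    exchange : ∀ e → 𝟙 (swapped e) + 𝟙 (c e ∧ lookup M e) ≡ 𝟙 (lookup M e) + 𝟙 (c e ∧ lookup H e)
    exchange e with c e
    ... | true  = +-comm (𝟙 (lookup H e)) _
    ... | false = refl

  module _ (c⊆M⊕H : ∀ e → c e ≡ true → lookup M e ≡ not (lookup H e)) where

    ∣swapIn∩H∣≡ : ∣ swapIn c M H ∩ H ∣ ≡ ∣ M ∩ H ∣ + countIn c H
    ∣swapIn∩H∣≡ = begin
      ∣ swapIn c M H ∩ H ∣                                   ≡⟨ ∣∩∣≡count (swapIn c M H) H ⟩
      count (λ e → lookup (swapIn c M H) e ∧ lookup H e)     ≡⟨ count-split _ _ _ split ⟩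
      count (λ e → lookup M e ∧ lookup H e) + countIn c H    ≡⟨ cong (_+ countIn c H) (∣∩∣≡count M H) ⟨
      ∣ M ∩ H ∣ + countIn c H                                ∎
      where
      open ≡-Reasoning
      split : ∀ e →
        𝟙 (lookup (swapIn c M H) e ∧ lookup H e) ≡ 𝟙 (lookup M e ∧ lookup H e) + 𝟙 (c e ∧ lookup H e)
      split e rewrite lookup-swapIn c M H e with c e in ce
      ... | false = sym (+-identityʳ _)
      ... | true  rewrite c⊆M⊕H e ce with lookup H e
      ...   | true  = refl
      ...   | false = refl

    swapIn-improves : countIn c M ≤ countIn c H → 1 ≤ countIn c H →
      ∣ M ∣ ≤ ∣ swapIn c M H ∣ × ∣ M ∩ H ∣ < ∣ swapIn c M H ∩ H ∣
    swapIn-improves M≤H 1≤H = +-cancelʳ-≤ (countIn c H) _ _ size , meets-H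
      where
      open ≤-Reasoning
      size : ∣ M ∣ + countIn c H ≤ ∣ swapIn c M H ∣ + countIn c H
      size = begin
        ∣ M ∣ + countIn c H              ≡⟨ ∣swapIn∣+countIn≡ ⟨
        ∣ swapIn c M H ∣ + countIn c M   ≤⟨ +-monoʳ-≤ ∣ swapIn c M H ∣ M≤H ⟩
        ∣ swapIn c M H ∣ + countIn c H   ∎
      meets-H : ∣ M ∩ H ∣ < ∣ swapIn c M H ∩ H ∣
      meets-H = begin-strict
        ∣ M ∩ H ∣                  <⟨ ℕ.m<m+n ∣ M ∩ H ∣ 1≤H ⟩
        ∣ M ∩ H ∣ + countIn c H    ≡⟨ ∣swapIn∩H∣≡ ⟨
        ∣ swapIn c M H ∩ H ∣       ∎

inc? : ∀ G e v → Dec (Inc G e v)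
inc? G e v = (Graph.src G e ≟ v) ⊎-dec (Graph.tgt G e ≟ v)

matching-unique : ∀ G {A : Subset (Graph.m G)} → IsMatching G A → ∀ {e f v} →
  lookup A e ≡ true → lookup A f ≡ true → Inc G e v → Inc G f v → e ≡ f
matching-unique G {A} A-matching {e} {f} {v} Ae Af ev fv with e ≟ f
... | yes e≡f = e≡f
... | no  e≢f = ⊥-elim (A-matching e f (lookup⇒[]= e A Ae) (lookup⇒[]= f A Af) e≢f v ev fv)

module Paths (G : Graph) where
  open Graph G

  OnPath : Path G → Fin m → Set
  OnPath p e = Σ (Fin (len p)) λ i → edge p i ≡ e

  joins-sym : ∀ {f u v} → Joins G f u v → Joins G f v u
  joins-sym (inj₁ uv) = inj₂ uv
  joins-sym (inj₂ vu) = inj₁ vu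

  joins⇒inc₁ : ∀ {f u v} → Joins G f u v → Inc G f u
  joins⇒inc₁ (inj₁ (su , _)) = inj₁ su
  joins⇒inc₁ (inj₂ (_ , tu)) = inj₂ tu

  joins⇒inc₂ : ∀ {f u v} → Joins G f u v → Inc G f v
  joins⇒inc₂ = joins⇒inc₁ ∘ joins-sym

  inc-joins : ∀ {f u v w} → Joins G f u v → Inc G f w → w ≡ u ⊎ w ≡ v
  inc-joins (inj₁ (su , tv)) (inj₁ sw) = inj₁ (trans (sym sw) su)
  inc-joins (inj₁ (su , tv)) (inj₂ tw) = inj₂ (trans (sym tw) tv)
  inc-joins (inj₂ (sv , tu)) (inj₁ sw) = inj₂ (trans (sym sw) sv)
  inc-joins (inj₂ (sv , tu)) (inj₂ tw) = inj₁ (trans (sym tw) tu)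

  other-end : ∀ {f v} → Inc G f v → Σ (Fin n) λ w → Joins G f v w × w ≢ v
  other-end {f} (inj₁ sv) = tgt f , inj₁ (sv , refl) , λ tv → loopless f (trans sv (sym tv))
  other-end {f} (inj₂ tv) = src f , inj₂ (refl , tv) , λ sv → loopless f (trans sv (sym tv))

  edgePath : Fin m → Path G
  edgePath e = record
    { len = 1 ; vert = ends ; vinj = ends-inj ; edge = λ _ → e ; joins = λ { fzero → inj₁ (refl , refl) } }
    where
    ends : Fin 2 → Fin n
    ends fzero        = src e
    ends (fsuc fzero) = tgt e
    ends-inj : ∀ i j → ends i ≡ ends j → i ≡ j
    ends-inj fzero        fzero        _  = refl
    ends-inj fzero        (fsuc fzero) st = ⊥-elim (loopless e st)
    ends-inj (fsuc fzero) fzero        ts = ⊥-elim (loopless e (sym ts))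
    ends-inj (fsuc fzero) (fsuc fzero) _  = refl

  edge-injective : ∀ (p : Path G) i j → edge p i ≡ edge p j → i ≡ j
  edge-injective p i j eq
    with inc-joins (joins p j) (subst (λ e → Inc G e _) eq (joins⇒inc₁ (joins p i)))
       | inc-joins (joins p j) (subst (λ e → Inc G e _) eq (joins⇒inc₂ (joins p i)))
  ... | inj₁ ii | _       = inject₁-injective (vinj p _ _ ii)
  ... | inj₂ _  | inj₂ ss = suc-injective (vinj p _ _ ss)
  ... | inj₂ is | inj₁ si = ⊥-elim (ℕ.<-asym j<i i<j)
    where
    j<i : toℕ j < toℕ i
    j<i = ℕ.≤-reflexive (trans (cong toℕ (sym (vinj p _ _ is))) (toℕ-inject₁ i))
    i<j : toℕ i < toℕ j
    i<j = ℕ.≤-reflexive (trans (cong toℕ (vinj p _ _ si)) (toℕ-inject₁ j))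

  module _ (p : Path G) {f : Fin m} {w : Fin n} (fresh : ∀ k → vert p k ≢ w) where

    prepend : Joins G f w (vert p fzero) → Path G
    prepend wp = record { len = suc (len p) ; vert = vert′ ; vinj = vinj′ ; edge = edge′ ; joins = joins′ }
      where
      vert′ : Fin (suc (suc (len p))) → Fin n
      vert′ fzero    = w
      vert′ (fsuc k) = vert p k
      vinj′ : ∀ i j → vert′ i ≡ vert′ j → i ≡ j
      vinj′ fzero    fzero    _  = refl
      vinj′ fzero    (fsuc j) eq = ⊥-elim (fresh j (sym eq))
      vinj′ (fsuc i) fzero    eq = ⊥-elim (fresh i eq)
      vinj′ (fsuc i) (fsuc j) eq = cong fsuc (vinj p i j eq)
      edge′ : Fin (suc (len p)) → Fin m
      edge′ fzero    = f
      edge′ (fsuc i) = edge p i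
      joins′ : ∀ i → Joins G (edge′ i) (vert′ (inject₁ i)) (vert′ (fsuc i))
      joins′ fzero    = wp
      joins′ (fsuc i) = joins p i

    prepend-proper : (wp : Joins G f w (vert p fzero)) → ProperSubpath G p (prepend wp)
    prepend-proper wp =
      ≤-refl , 1 , ≤-refl , λ { i (fsuc j) eq → cong (edge p) (toℕ-injective (sym (ℕ.suc-injective eq))) }

    append : Joins G f (vert p (fromℕ (len p))) w → Path G
    append pw = record { len = suc (len p) ; vert = vert′ ; vinj = vinj′ ; edge = edge′ ; joins = joins′ }
      where
      vert′ : Fin (suc (suc (len p))) → Fin n
      vert′ = insertAt (vert p) (fromℕ (suc (len p))) w
      edge′ : Fin (suc (len p)) → Fin m
      edge′ = insertAt (edge p) (fromℕ (len p)) f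
      old-vert : ∀ k → vert′ (inject₁ k) ≡ vert p k
      old-vert = insertAt-last-inject₁ (vert p) w
      new-vert : vert′ (fromℕ (suc (len p))) ≡ w
      new-vert = insertAt-lookup (vert p) (fromℕ (suc (len p))) w
      vinj′ : ∀ i j → vert′ i ≡ vert′ j → i ≡ j
      vinj′ i j eq with inject₁-or-last i | inject₁-or-last j
      ... | inj₁ (i′ , refl) | inj₁ (j′ , refl) =
        cong inject₁ (vinj p i′ j′ (trans (sym (old-vert i′)) (trans eq (old-vert j′))))
      ... | inj₁ (i′ , refl) | inj₂ refl        =
        ⊥-elim (fresh i′ (trans (sym (old-vert i′)) (trans eq new-vert)))
      ... | inj₂ refl        | inj₁ (j′ , refl) =
        ⊥-elim (fresh j′ (trans (sym (old-vert j′)) (trans (sym eq) new-vert)))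
      ... | inj₂ refl        | inj₂ refl        = refl
      joins′ : ∀ i → Joins G (edge′ i) (vert′ (inject₁ i)) (vert′ (fsuc i))
      joins′ i with inject₁-or-last i
      ... | inj₁ (i′ , refl)
        rewrite insertAt-last-inject₁ (edge p) f i′ | old-vert (inject₁ i′) | old-vert (fsuc i′) = joins p i′
      ... | inj₂ refl
        rewrite insertAt-lookup (edge p) (fromℕ (len p)) f | old-vert (fromℕ (len p)) | new-vert = pw

    append-proper : (pw : Joins G f (vert p (fromℕ (len p))) w) → ProperSubpath G p (append pw)
    append-proper pw = ≤-refl , 0 , ℕ.n≤1+n (len p) , old-edge
      where
      old-edge : ∀ i j → toℕ j ≡ toℕ i → edge p i ≡ edge (append pw) j
      old-edge i j eq rewrite toℕ-injective (trans eq (sym (toℕ-inject₁ i))) =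
        sym (insertAt-last-inject₁ (edge p) f i)

  OnPath-proper : ∀ {p q e} → ProperSubpath G p q → OnPath p e → OnPath q e
  OnPath-proper {p} {q} (_ , k , k+p≤q , shift) (i , pi≡e) =
    fromℕ< k+i<q , trans (sym (shift i _ (toℕ-fromℕ< k+i<q))) pi≡e
    where
    k+i<q : k + toℕ i < len q
    k+i<q = ≤-trans (ℕ.+-monoʳ-< k (toℕ<n i)) k+p≤q

  len<n : ∀ (p : Path G) → len p < n
  len<n p = injective⇒≤ (λ {i} {j} → vinj p i j)

  -- Maximality is not decidable, so rather than extend p to a maximal path we refute that every maximal
  -- path avoids e, by recursion on how many of the n vertices p does not yet use.
  module _ {A B : Subset m} {e : Fin m} (avoids : ∀ q → IsMaximalAltPath G A B q → ¬ OnPath q e) where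

    private
      no-alt-path-through : ∀ fuel (p : Path G) → n ≤ len p + fuel → IsAltPath G A B p → ¬ OnPath p e
      no-alt-path-through zero       p n≤p _   _   = ℕ.<⇒≱ (len<n p) (subst (n ≤_) (+-identityʳ (len p)) n≤p)
      no-alt-path-through (suc fuel) p n≤p alt e∈p = avoids p (alt , not-extendable) e∈p
        where
        not-extendable : ∀ (q : Path G) → IsAltPath G A B q → ¬ ProperSubpath G p q
        not-extendable q alt-q p⊂q = no-alt-path-through fuel q n≤q alt-q (OnPath-proper {p} {q} p⊂q e∈p)
          where
          n≤q : n ≤ len q + fuel
          n≤q = ≤-trans n≤p
            (subst (_≤ len q + fuel) (sym (ℕ.+-suc (len p) fuel)) (ℕ.+-monoˡ-≤ fuel (proj₁ p⊂q)))

    alt-edge-off-maximal-paths : ∀ (p : Path G) → IsAltPath G A B p → ¬ OnPath p e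
    alt-edge-off-maximal-paths p = no-alt-path-through n p (m≤n+m n (len p))

module Alternating (G : Graph) (M H : Subset (Graph.m G)) where
  open Graph G
  open Paths G

  -- Colour true marks an edge of M ∖ H, colour false an edge of H ∖ M; alternate s k is the colour of
  -- the k-th edge (counting from 0) of an alternating path whose first edge has colour s.
  Coloured : Bool → Fin m → Set
  Coloured b e = lookup M e ≡ b × lookup H e ≡ not b

  AlternatesFrom : Bool → Path G → Set
  AlternatesFrom s p = ∀ i → Coloured (alternate s (toℕ i)) (edge p i)

  private
    Diff : Bool → Fin m → Set
    Diff b e = if b then InDiff G M H e else InDiff G H M e

    diff⇒coloured : ∀ b {e} → Diff b e → Coloured b e
    diff⇒coloured true  (e∈M , e∉H) = []=⇒lookup e∈M , lookup-∉ H e∉H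
    diff⇒coloured false (e∈H , e∉M) = lookup-∉ M e∉M , []=⇒lookup e∈H

    coloured⇒diff : ∀ b {e} → Coloured b e → Diff b e
    coloured⇒diff true  {e} (Me , He) = lookup⇒[]= e M Me , ∉-lookup H He
    coloured⇒diff false {e} (Me , He) = lookup⇒[]= e H He , ∉-lookup M Me

    diff-alternate : ∀ s k e → (if isEven G k then Diff s e else Diff (not s) e) ≡ Diff (alternate s k) e
    diff-alternate s k e rewrite alternate-isEven G s k with isEven G k
    ... | true  = refl
    ... | false = refl

  altPath⇒alternates : ∀ {p} → IsAltPath G M H p → Σ Bool λ s → AlternatesFrom s p
  altPath⇒alternates {p} (_ , inj₁ alt) =
    true  , λ i → diff⇒coloured _ (subst id (diff-alternate true  (toℕ i) (edge p i)) (alt i))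
  altPath⇒alternates {p} (_ , inj₂ alt) =
    false , λ i → diff⇒coloured _ (subst id (diff-alternate false (toℕ i) (edge p i)) (alt i))

  alternates⇒altPath : ∀ {p} s → 1 ≤ len p → AlternatesFrom s p → IsAltPath G M H p
  alternates⇒altPath {p} true  1≤p alt =
    1≤p , inj₁ λ i → subst id (sym (diff-alternate true  (toℕ i) (edge p i))) (coloured⇒diff _ (alt i))
  alternates⇒altPath {p} false 1≤p alt =
    1≤p , inj₂ λ i → subst id (sym (diff-alternate false (toℕ i) (edge p i))) (coloured⇒diff _ (alt i))

  module _ {p : Path G} {s : Bool} (alt : AlternatesFrom s p)
           {f : Fin m} {w : Fin n} (fresh : ∀ k → vert p k ≢ w) where

    prepend-alternates : (wp : Joins G f w (vert p fzero)) → Coloured (not s) f →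
      AlternatesFrom (not s) (prepend p fresh wp)
    prepend-alternates wp cf fzero    = cf
    prepend-alternates wp cf (fsuc i) = subst (λ b → Coloured b (edge p i)) (sym not-alternate-not) (alt i)
      where
      not-alternate-not : not (alternate (not s) (toℕ i)) ≡ alternate s (toℕ i)
      not-alternate-not = trans (cong not (alternate-not s (toℕ i))) (not-involutive _)

    append-alternates : (pw : Joins G f (vert p (fromℕ (len p))) w) → Coloured (alternate s (len p)) f →
      AlternatesFrom s (append p fresh pw)
    append-alternates pw cf i with inject₁-or-last i
    ... | inj₁ (i′ , refl) = subst₂ (λ k e → Coloured (alternate s k) e)
                               (sym (toℕ-inject₁ i′)) (sym (insertAt-last-inject₁ (edge p) f i′)) (alt i′)
    ... | inj₂ refl        = subst₂ (λ k e → Coloured (alternate s k) e)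
                               (sym (toℕ-fromℕ (len p))) (sym (insertAt-lookup (edge p) (fromℕ (len p)) f)) cf

  module _ {p : Path G} (maximal : IsMaximalAltPath G M H p) {s : Bool} (alt : AlternatesFrom s p) where

    start-closed : ∀ {f w} → Coloured (not s) f → Joins G f (vert p fzero) w →
      Σ (Fin (suc (len p))) λ k → vert p k ≡ w
    start-closed {f} {w} cf pw with any? (λ k → vert p k ≟ w)
    ... | yes found = found
    ... | no  fresh = ⊥-elim (proj₂ maximal longer longer-alternates (prepend-proper p fresh′ (joins-sym pw)))
      where
      fresh′ : ∀ k → vert p k ≢ w
      fresh′ k eq = fresh (k , eq)
      longer : Path G
      longer = prepend p fresh′ (joins-sym pw)
      longer-alternates : IsAltPath G M H longer
      longer-alternates =
        alternates⇒altPath {longer} (not s) (s≤s z≤n) (prepend-alternates {p} alt fresh′ (joins-sym pw) cf)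

    end-closed : ∀ {f w} → Coloured (alternate s (len p)) f → Joins G f (vert p (fromℕ (len p))) w →
      Σ (Fin (suc (len p))) λ k → vert p k ≡ w
    end-closed {f} {w} cf pw with any? (λ k → vert p k ≟ w)
    ... | yes found = found
    ... | no  fresh = ⊥-elim (proj₂ maximal longer longer-alternates (append-proper p fresh′ pw))
      where
      fresh′ : ∀ k → vert p k ≢ w
      fresh′ k eq = fresh (k , eq)
      longer : Path G
      longer = append p fresh′ pw
      longer-alternates : IsAltPath G M H longer
      longer-alternates = alternates⇒altPath {longer} s (s≤s z≤n) (append-alternates {p} alt fresh′ pw cf)

-- Augmenting along a maximal path with an H-edge at one end

Improves : (G : Graph) (M H N : Subset (Graph.m G)) → Set
Improves G M H N = IsMatching G N × ∣ M ∣ ≤ ∣ N ∣ × ∣ M ∩ H ∣ < ∣ N ∩ H ∣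

module Augmentation (G : Graph) {M H : Subset (Graph.m G)} (M-matching : IsMatching G M) (H-matching : IsMatching G H)
  (L : ℕ) (vt : Fin (suc (suc L)) → Fin (Graph.n G)) (vt-inj : ∀ i j → vt i ≡ vt j → i ≡ j)
  (ed : Fin (suc L) → Fin (Graph.m G)) (ed-joins : ∀ i → Joins G (ed i) (vt (inject₁ i)) (vt (fsuc i)))
  (s : Bool) (alt : ∀ i → Alternating.Coloured G M H (alternate s (toℕ i)) (ed i))
  where
  open Graph G
  open Paths G
  open Alternating G M H

  path : Path G
  path = record { len = suc L ; vert = vt ; vinj = vt-inj ; edge = ed ; joins = ed-joins }

  last : Fin (suc (suc L))
  last = fromℕ (suc L)

  Visited : Fin n → Set
  Visited w = Σ (Fin (suc (suc L))) λ k → vt k ≡ w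

  colour : Fin (suc L) → Bool
  colour i = alternate s (toℕ i)

  M-on-path H-on-path : ℕ
  M-on-path = count colour
  H-on-path = count {suc L} (alternate (not s) ∘ toℕ)

  Covered : Fin (suc (suc L)) → Set
  Covered j = Σ (Fin (suc L)) λ i → colour i ≡ true × Inc G (ed i) (vt j)

  -- An edge appended after the last edge ed L would have colour alternate s (suc L), so that colour is
  -- true exactly when ed L is an H-edge.
  HEnd : Fin (suc (suc L)) → Set
  HEnd j = (j ≡ fzero × s ≡ false) ⊎ (j ≡ last × alternate s (suc L) ≡ true)

  vertex-cover : ∀ j → Covered j ⊎ HEnd j
  vertex-cover fzero = by-start-colour s refl
    where
    by-start-colour : ∀ b → s ≡ b → Covered fzero ⊎ HEnd fzero
    by-start-colour true  s≡true  = inj₁ (fzero , s≡true , joins⇒inc₁ (ed-joins fzero))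
    by-start-colour false s≡false = inj₂ (inj₁ (refl , s≡false))
  vertex-cover (fsuc j) with colour j in cj | inject₁-or-last j
  ... | true  | _               = inj₁ (j , cj , joins⇒inc₂ (ed-joins j))
  ... | false | inj₁ (i , refl) = inj₁ (fsuc i , cong not (trans (cong (alternate s) (sym (toℕ-inject₁ i))) cj)
                                                 , joins⇒inc₁ (ed-joins (fsuc i)))
  ... | false | inj₂ refl       = inj₂ (inj₂ (refl , cong not (trans (cong (alternate s) (sym (toℕ-fromℕ L))) cj)))

  start-covered : s ≡ true → Covered fzero
  start-covered s≡true with vertex-cover fzero
  ... | inj₁ covered              = covered
  ... | inj₂ (inj₁ (_ , s≡false)) with () ← trans (sym s≡true) s≡false
  ... | inj₂ (inj₂ (() , _))

  end-covered : alternate s (suc L) ≡ false → Covered last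
  end-covered ends-M with vertex-cover last
  ... | inj₁ covered             = covered
  ... | inj₂ (inj₁ (() , _))
  ... | inj₂ (inj₂ (_ , ends-H)) with () ← trans (sym ends-M) ends-H

  onPath : Fin m → Bool
  onPath = inImage ed

  onPath-sound : ∀ {e} → onPath e ≡ true → Σ (Fin (suc L)) λ i → ed i ≡ e
  onPath-sound {e} = does-true (any? λ i → ed i ≟ e)

  onPath-edge : ∀ i → onPath (ed i) ≡ true
  onPath-edge i = dec-true (any? λ j → ed j ≟ ed i) (i , refl)

  covered⇒onPath : ∀ {j f} → Covered j → lookup M f ≡ true → Inc G f (vt j) → onPath f ≡ true
  covered⇒onPath (i , ci , ed-at-j) Mf f-at-j = subst (λ e → onPath e ≡ true)
    (matching-unique G M-matching (trans (proj₁ (alt i)) ci) Mf ed-at-j f-at-j) (onPath-edge i)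

  -- An edge of M ∖ H joining the two ends closes the path into an even alternating cycle; it has to be
  -- exchanged together with the path.
  Closing : Fin m → Set
  Closing e = Coloured true e × Inc G e (vt fzero) × Inc G e (vt last) × onPath e ≡ false

  closing? : ∀ e → Dec (Closing e)
  closing? e = ((lookup M e ≟ᵇ true) ×-dec (lookup H e ≟ᵇ false)) ×-dec
               (inc? G e (vt fzero) ×-dec (inc? G e (vt last) ×-dec (onPath e ≟ᵇ false)))

  closing : Fin m → Bool
  closing e = does (closing? e)

  closing-sound : ∀ {e} → closing e ≡ true → Closing e
  closing-sound {e} = does-true (closing? e)

  closing-complete : ∀ {e} → Closing e → closing e ≡ true
  closing-complete {e} = dec-true (closing? e)

  closing-none : ∀ {j} → j ≡ fzero ⊎ j ≡ last → Covered j → count closing ≡ 0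
  closing-none {j} end covered = count-false closing not-closing
    where
    at-end : ∀ {e} → j ≡ fzero ⊎ j ≡ last → Inc G e (vt fzero) → Inc G e (vt last) → Inc G e (vt j)
    at-end (inj₁ refl) e-at-0 _         = e-at-0
    at-end (inj₂ refl) _      e-at-last = e-at-last
    not-closing : ∀ e → closing e ≡ false
    not-closing e = dec-false (closing? e) λ ((Me , _) , e-at-0 , e-at-last , off) →
      not-¬ (covered⇒onPath covered Me (at-end end e-at-0 e-at-last)) off

  closing-unique : count closing ≤ 1
  closing-unique = count-unique closing λ e f ce cf →
    let ((Me , _) , e-at-0 , _) = closing-sound ce
        ((Mf , _) , f-at-0 , _) = closing-sound cf
    in matching-unique G M-matching Me Mf e-at-0 f-at-0

  swapped : Fin m → Bool
  swapped e = onPath e ∨ closing e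

  onPath⇒swapped : ∀ {e} → onPath e ≡ true → swapped e ≡ true
  onPath⇒swapped on rewrite on = refl

  closing⇒swapped : ∀ {e} → closing e ≡ true → swapped e ≡ true
  closing⇒swapped {e} c = trans (cong (onPath e ∨_) c) (∨-zeroʳ (onPath e))

  swapped-off-path⇒Closing : ∀ {e} → swapped e ≡ true → onPath e ≢ true → Closing e
  swapped-off-path⇒Closing {e} Ce off = closing-sound (subst (λ b → b ∨ closing e ≡ true) (¬-not off) Ce)

  swapped⇒M⊕H : ∀ e → swapped e ≡ true → lookup M e ≡ not (lookup H e)
  swapped⇒M⊕H e Ce with onPath e ≟ᵇ true
  ... | yes on with i , refl ← onPath-sound on =
    let (Me , He) = alt i in trans Me (trans (sym (not-involutive _)) (cong not (sym He)))
  ... | no  off = let ((Me , He) , _) = swapped-off-path⇒Closing Ce off in trans Me (cong not (sym He))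

  swapped-H⇒onPath : ∀ {e} → swapped e ≡ true → lookup H e ≡ true → Σ (Fin (suc L)) λ i → ed i ≡ e
  swapped-H⇒onPath {e} Ce He with onPath e ≟ᵇ true
  ... | yes on  = onPath-sound on
  ... | no  off with () ← trans (sym He) (proj₂ (proj₁ (swapped-off-path⇒Closing Ce off)))

  joins-ends⇒swapped : ∀ {f} → Coloured true f → Inc G f (vt fzero) → Inc G f (vt last) → swapped f ≡ true
  joins-ends⇒swapped {f} cf f-at-0 f-at-last with onPath f ≟ᵇ true
  ... | yes on  = onPath⇒swapped on
  ... | no  off = closing⇒swapped (closing-complete (cf , f-at-0 , f-at-last , ¬-not off))

  joins-H-ends⇒swapped : ∀ {j k f} → HEnd j → HEnd k → j ≢ k →
    Coloured true f → Inc G f (vt j) → Inc G f (vt k) → swapped f ≡ true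
  joins-H-ends⇒swapped (inj₁ (refl , _)) (inj₁ (refl , _)) j≢k = ⊥-elim (j≢k refl)
  joins-H-ends⇒swapped (inj₂ (refl , _)) (inj₂ (refl , _)) j≢k = ⊥-elim (j≢k refl)
  joins-H-ends⇒swapped (inj₁ (refl , _)) (inj₂ (refl , _)) _ cf f-at-0 f-at-last = joins-ends⇒swapped cf f-at-0 f-at-last
  joins-H-ends⇒swapped (inj₂ (refl , _)) (inj₁ (refl , _)) _ cf f-at-last f-at-0 = joins-ends⇒swapped cf f-at-0 f-at-last

  swapped-M-count : countIn swapped M ≡ M-on-path + count closing
  swapped-M-count = begin
    count (λ e → swapped e ∧ lookup M e)                 ≡⟨ count-split _ _ _ split ⟩
    count (λ e → onPath e ∧ lookup M e) + count closing  ≡⟨ cong (_+ count closing) path-count ⟩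
    M-on-path + count closing                            ∎
    where
    open ≡-Reasoning
    split : ∀ e → 𝟙 (swapped e ∧ lookup M e) ≡ 𝟙 (onPath e ∧ lookup M e) + 𝟙 (closing e)
    split e = 𝟙-∨-disjoint (onPath e) (closing e) (lookup M e)
                (proj₂ ∘ proj₂ ∘ proj₂ ∘ closing-sound) (proj₁ ∘ proj₁ ∘ closing-sound)
    path-count : count (λ e → onPath e ∧ lookup M e) ≡ M-on-path
    path-count = trans (count-image ed (edge-injective path) (lookup M)) (count-cong (proj₁ ∘ alt))

  swapped-H-count : countIn swapped H ≡ H-on-path
  swapped-H-count = begin
    count (λ e → swapped e ∧ lookup H e)
      ≡⟨ sum-cong-≗ (λ e → 𝟙-∨-absent (onPath e) _ _ (proj₂ ∘ proj₁ ∘ closing-sound)) ⟩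
    count (λ e → onPath e ∧ lookup H e)
      ≡⟨ count-image ed (edge-injective path) (lookup H) ⟩
    count (lookup H ∘ ed)
      ≡⟨ count-cong (λ i → trans (proj₂ (alt i)) (sym (alternate-not s (toℕ i)))) ⟩
    H-on-path                                  ∎
    where open ≡-Reasoning

  path-balance : s ≡ false ⊎ alternate s (suc L) ≡ true → M-on-path + count closing ≤ H-on-path × 1 ≤ H-on-path
  path-balance = by-start-colour s refl
    where
    A : Bool → ℕ
    A b = count {suc L} (alternate b ∘ toℕ)
    A-true-pos : 1 ≤ A true
    A-true-pos = count-true {suc L} (alternate true ∘ toℕ) fzero refl
    by-start-colour : ∀ b → s ≡ b → b ≡ false ⊎ alternate b (suc L) ≡ true →
      A b + count closing ≤ A (not b) × 1 ≤ A (not b)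
    by-start-colour false s≡false _ =
      subst (A false + count closing ≤_) (sym (count-alternate (suc L))) (+-monoʳ-≤ (A false) closing≤) , A-true-pos
      where
      closing≤ : count closing ≤ 𝟙 (alternate false (suc L))
      closing≤ with alternate false (suc L) ≟ᵇ true
      ... | yes ends-H rewrite ends-H = closing-unique
      ... | no  ends-M rewrite ¬-not ends-M = ≤-reflexive (closing-none (inj₂ refl) (end-covered ends-M′))
        where
        ends-M′ : alternate s (suc L) ≡ false
        ends-M′ = subst (λ b → alternate b (suc L) ≡ false) (sym s≡false) (¬-not ends-M)
    by-start-colour true  s≡true  (inj₁ ())
    by-start-colour true  s≡true  (inj₂ ends-H) =
        ≤-reflexive (trans (cong (A true +_) (closing-none (inj₁ refl) (start-covered s≡true))) balanced)
      , subst (1 ≤_) (trans (sym (+-identityʳ (A true))) balanced) A-true-pos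
      where
      open ≡-Reasoning
      balanced : A true + 0 ≡ A false
      balanced = begin
        A true + 0                              ≡⟨ +-identityʳ (A true) ⟩
        A true                                  ≡⟨ count-alternate (suc L) ⟩
        A false + 𝟙 (alternate false (suc L))   ≡⟨ cong (λ b → A false + 𝟙 b) ends-with-H ⟩
        A false + 0                             ≡⟨ +-identityʳ (A false) ⟩
        A false                                 ∎
        where
        ends-with-H : alternate false (suc L) ≡ false
        ends-with-H = trans (alternate-not true (suc L)) (cong not ends-H)

  module _ (H-ends-closed : ∀ {j f w} → HEnd j → Coloured true f → Joins G f (vt j) w → Visited w) where

    M∖H-edge-at-path⇒swapped : ∀ j {f} → Coloured true f → Inc G f (vt j) → swapped f ≡ true
    M∖H-edge-at-path⇒swapped j {f} cf f-at-j with vertex-cover j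
    ... | inj₁ covered = onPath⇒swapped (covered⇒onPath covered (proj₁ cf) f-at-j)
    ... | inj₂ H-end-j with other-end f-at-j
    ... | w , jw , w≢vj with H-ends-closed H-end-j cf jw
    ... | k , vk≡w with subst (Inc G f) (sym vk≡w) (joins⇒inc₂ jw) | vertex-cover k
    ...   | f-at-k | inj₁ covered = onPath⇒swapped (covered⇒onPath covered (proj₁ cf) f-at-k)
    ...   | f-at-k | inj₂ H-end-k =
      joins-H-ends⇒swapped H-end-j H-end-k (λ j≡k → w≢vj (trans (sym vk≡w) (cong vt (sym j≡k)))) cf f-at-j f-at-k

    swapped-H-edge-forces : ∀ {e f v} → swapped e ≡ true → lookup H e ≡ true → Coloured true f →
      Inc G e v → Inc G f v → swapped f ≡ true
    swapped-H-edge-forces Ce He cf e-at-v f-at-v with i , refl ← swapped-H⇒onPath Ce He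
      with inc-joins (ed-joins i) e-at-v
    ... | inj₁ refl = M∖H-edge-at-path⇒swapped (inject₁ i) cf f-at-v
    ... | inj₂ refl = M∖H-edge-at-path⇒swapped (fsuc i) cf f-at-v

    H-edge-meets-M-edge : ∀ {e f v} → swapped e ≡ true → e ∈ H → swapped f ≡ false → f ∈ M → e ≢ f →
      Inc G e v → Inc G f v → ⊥
    H-edge-meets-M-edge {e} {f} {v} Ce e∈H Cf f∈M e≢f e-at-v f-at-v with lookup H f ≟ᵇ true
    ... | yes Hf = H-matching e f e∈H (lookup⇒[]= f H Hf) e≢f v e-at-v f-at-v
    ... | no ¬Hf with () ←
          trans (sym Cf) (swapped-H-edge-forces Ce ([]=⇒lookup e∈H) ([]=⇒lookup f∈M , ¬-not ¬Hf) e-at-v f-at-v)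

    swapIn-matching : IsMatching G (swapIn swapped M H)
    swapIn-matching e f e∈N f∈N e≢f v e-at-v f-at-v with ∈-swapIn swapped M H e∈N | ∈-swapIn swapped M H f∈N
    ... | inj₁ (_ , e∈H)  | inj₁ (_ , f∈H)  = H-matching e f e∈H f∈H e≢f v e-at-v f-at-v
    ... | inj₂ (_ , e∈M)  | inj₂ (_ , f∈M)  = M-matching e f e∈M f∈M e≢f v e-at-v f-at-v
    ... | inj₁ (Ce , e∈H) | inj₂ (Cf , f∈M) = H-edge-meets-M-edge Ce e∈H Cf f∈M e≢f e-at-v f-at-v
    ... | inj₂ (Ce , e∈M) | inj₁ (Cf , f∈H) = H-edge-meets-M-edge Cf f∈H Ce e∈M (e≢f ∘ sym) f-at-v e-at-v

    improvement : s ≡ false ⊎ alternate s (suc L) ≡ true → Σ (Subset m) (Improves G M H)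
    improvement ends = swapIn swapped M H , swapIn-matching , swapIn-improves swapped M H swapped⇒M⊕H
      (subst₂ _≤_ (sym swapped-M-count) (sym swapped-H-count) (proj₁ (path-balance ends)))
      (subst (1 ≤_) (sym swapped-H-count) (proj₂ (path-balance ends)))

module Standing (G : Graph) {H H' M : Subset (Graph.m G)} (choice : StandingChoice G H H' M) where
  open Graph G
  open Paths G
  open Alternating G M H

  H-matching : IsMatching G H
  H-matching = proj₁ (proj₁ (proj₁ (proj₁ choice)))

  M-maximum : IsMaximumMatching G M
  M-maximum = proj₁ (proj₂ choice)

  no-better-matching : ¬ Σ (Subset m) (Improves G M H)
  no-better-matching (N , N-matching , M≤N , M∩H<N∩H) =
    ℕ.<⇒≱ M∩H<N∩H (proj₁ (proj₂ (proj₂ choice)) H H' N (proj₁ choice) N-maximum)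
    where
    N-maximum : IsMaximumMatching G N
    N-maximum = N-matching , λ K K-matching → ≤-trans (proj₂ M-maximum K K-matching) M≤N

  maximal⇒PoM : ∀ p → IsMaximalAltPath G M H p → InPoA G M H p
  maximal⇒PoM record { len = zero } ((() , _) , _)
  maximal⇒PoM p@record { len = suc L ; vert = vt ; vinj = vt-inj ; edge = ed ; joins = ed-joins } maximal =
    by-end-colours (s ≟ᵇ true) (alternate s (suc L) ≟ᵇ true)
    where
    s : Bool
    s = proj₁ (altPath⇒alternates {p} (proj₁ maximal))
    alt : AlternatesFrom s p
    alt = proj₂ (altPath⇒alternates {p} (proj₁ maximal))
    open Augmentation G (proj₁ M-maximum) H-matching L vt vt-inj ed ed-joins s alt
    H-ends-closed : ∀ {j f w} → HEnd j → Coloured true f → Joins G f (vt j) w → Visited w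
    H-ends-closed {f = f} (inj₁ (refl , s≡false)) cf =
      start-closed {p} maximal alt (subst (λ b → Coloured b f) (cong not (sym s≡false)) cf)
    H-ends-closed {f = f} (inj₂ (refl , ends-H))  cf =
      end-closed {p} maximal alt (subst (λ b → Coloured b f) (sym ends-H) cf)
    H-at-an-end-impossible : s ≡ false ⊎ alternate s (suc L) ≡ true → ⊥
    H-at-an-end-impossible = no-better-matching ∘ improvement H-ends-closed
    by-end-colours : Dec (s ≡ true) → Dec (alternate s (suc L) ≡ true) → InPoA G M H p
    by-end-colours (no s≢true) _            = ⊥-elim (H-at-an-end-impossible (inj₁ (¬-not s≢true)))
    by-end-colours _           (yes ends-H) = ⊥-elim (H-at-an-end-impossible (inj₂ ends-H))
    by-end-colours (yes s≡true) (no ends-M) = maximal , odd , starts-in-M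
      where
      odd : isEven G (suc L) ≡ false
      odd = trans (isEven≡alternate-true G (suc L))
                  (subst (λ b → alternate b (suc L) ≡ false) s≡true (¬-not ends-M))
      starts-in-M : ∀ i → toℕ i ≡ 0 → ed i ∈ M
      starts-in-M fzero _ = lookup⇒[]= (ed fzero) M (trans (proj₁ (alt fzero)) s≡true)

  M⊕H-edge-on-PoM : ∀ b {e} → Coloured b e → ¬ (∀ q → InPoA G M H q → ¬ OnPath q e)
  M⊕H-edge-on-PoM b {e} coloured avoids =
    alt-edge-off-maximal-paths (λ q maximal → avoids q (maximal⇒PoM q maximal))
      (edgePath e) (alternates⇒altPath {edgePath e} b (s≤s z≤n) λ { fzero → coloured }) (fzero , refl)

  M∩H-edge-off-PoM : ∀ {e} X → e ∈ M → e ∈ H → ¬ OnPoM G M H X e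
  M∩H-edge-off-PoM X e∈M e∈H (_ , q , PoM , i , qi≡e) with altPath⇒alternates {q} (proj₁ (proj₁ PoM))
  ... | _ , alt with alt i
  ... | Mq , Hq = not-¬ (trans (sym Me) Mq) (trans (sym He) Hq)
    where
    Me : lookup M (edge q i) ≡ true
    Me = trans (cong (lookup M) qi≡e) ([]=⇒lookup e∈M)
    He : lookup H (edge q i) ≡ true
    He = trans (cong (lookup H) qi≡e) ([]=⇒lookup e∈H)

  M∖M_A⊆H : ∀ {e} → e ∈ M → ¬ InMA G M H e → e ∈ H
  M∖M_A⊆H {e} e∈M e∉M_A with e ∈? H
  ... | yes e∈H = e∈H
  ... | no  e∉H = ⊥-elim (M⊕H-edge-on-PoM true ([]=⇒lookup e∈M , lookup-∉ H e∉H)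
                            λ q PoM on → e∉M_A (e∈M , q , PoM , on))

  H∖H_A⊆M : ∀ {e} → e ∈ H → ¬ InHA G M H e → e ∈ M
  H∖H_A⊆M {e} e∈H e∉H_A with e ∈? M
  ... | yes e∈M = e∈M
  ... | no  e∉M = ⊥-elim (M⊕H-edge-on-PoM false (lookup-∉ M e∉M , []=⇒lookup e∈H)
                            λ q PoM on → e∉H_A (e∈H , q , PoM , on))

corollary1 : (G : Graph) (H H' M : Subset (Graph.m G)) →
    StandingChoice G H H' M →
    (∀ (e : Fin (Graph.m G)) →
      ((e ∈ M × e ∈ H) ⇔ (e ∈ M × ¬ InMA G M H e)) ×
      ((e ∈ M × e ∈ H) ⇔ (e ∈ H × ¬ InHA G M H e)))
corollary1 G H H' M choice e =
    mk⇔ (λ (e∈M , e∈H) → e∈M , M∩H-edge-off-PoM M e∈M e∈H)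
        (λ (e∈M , e∉M_A) → e∈M , M∖M_A⊆H e∈M e∉M_A)
  , mk⇔ (λ (e∈M , e∈H) → e∈H , M∩H-edge-off-PoM H e∈M e∈H)
        (λ (e∈H , e∉H_A) → H∖H_A⊆M e∈H e∉H_A , e∈H)
  where open Standing G choice
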